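{- For every integer $n\ge 1$ and every integer $t$ with $1\le t\le n$, every graph on $n$ vertices is an $(n,t)$-threshold-PCG.
   Context: All graphs are finite, simple and undirected. For an edge-weighted tree $T$ (nonnegative real edge weights) and leaves $x,y$, $d_T(x,y)$ is the sum of the weights on the unique $x$–$y$ path; $L(T)$ is the leaf set. A graph $G=(V,E)$ is a PCG if there exist an edge-weighted tree $T$, reals $0\le d_{\min}\le d_{\max}$ and a bijection $\zeta:V\to L(T)$ such that for all distinct $u,v\in V$: $uv\in E \iff d_{\min}\le d_T(\zeta(u),\zeta(v))\le d_{\max}$. For integers $1\le t\le k$, $G=(V,E)$ is a $(k,t)$-threshold-PCG if there exist PCGs $G_1=(V,E_1),\dots,G_k=(V,E_k)$ on the same vertex set such that for all distinct $u,v\in V$: $uv\in E \iff |\{i\in\{1,\dots,k\}: uv\in E_i\}|\ge t$. -}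

module Defs where

open import Data.Nat using (ℕ; zero; suc; _≤_)
open import Data.Fin using (Fin)
open import Data.Bool using (Bool; true; false; if_then_else_)
open import Data.List using (List; []; _∷_; map; allFin)
open import Data.Nat.ListAction using (sum)
open import Data.List.Relation.Unary.Unique.Propositional using (Unique)
open import Data.Product using (Σ; ∃; _×_; _,_)
open import Data.Rational as ℚ using (ℚ; 0ℚ)
open import Function.Bundles using (_⇔_)
open import Relation.Binary.PropositionalEquality using (_≡_; _≢_)

record Graph (n : ℕ) : Set where
  field
    adj    : Fin n → Fin n → Bool
    sym    : ∀ u v → adj u v ≡ adj v u
    irrefl : ∀ u → adj u u ≡ false

Edge : ∀ {n} → Graph n → Fin n → Fin n → Set
Edge G u v = Graph.adj G u v ≡ true

data Chain {m : ℕ} (adj : Fin m → Fin m → Bool) : Fin m → Fin m → List (Fin m) → Set where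
  here : ∀ x → Chain adj x x (x ∷ [])
  step : ∀ {x y z vs} → adj x y ≡ true → Chain adj y z vs → Chain adj x z (x ∷ vs)

IsPath : ∀ {m} → (Fin m → Fin m → Bool) → Fin m → Fin m → List (Fin m) → Set
IsPath adj x y vs = Chain adj x y vs × Unique vs

pathWeight : ∀ {m} → (Fin m → Fin m → ℚ) → List (Fin m) → ℚ
pathWeight w (x ∷ y ∷ vs) = w x y ℚ.+ pathWeight w (y ∷ vs)
pathWeight w _            = 0ℚ

record WTree : Set where
  field
    size      : ℕ
    adj       : Fin size → Fin size → Bool
    sym       : ∀ x y → adj x y ≡ adj y x
    irrefl    : ∀ x → adj x x ≡ false
    connected : ∀ x y → ∃ λ vs → IsPath adj x y vs
    acyclic   : ∀ x y vs ws → IsPath adj x y vs → IsPath adj x y ws → vs ≡ ws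
    weight    : Fin size → Fin size → ℚ
    weight-sym : ∀ x y → weight x y ≡ weight y x
    weight-nonneg : ∀ x y → 0ℚ ℚ.≤ weight x y

IsLeaf : (T : WTree) → Fin (WTree.size T) → Set
IsLeaf T x = ∀ y z → WTree.adj T x y ≡ true → WTree.adj T x z ≡ true → y ≡ z

IsPCG : ∀ {n} → Graph n → Set
IsPCG {n} G =
  Σ WTree λ T → Σ ℚ λ dmin → Σ ℚ λ dmax → Σ (Fin n → Fin (WTree.size T)) λ ζ →
    (0ℚ ℚ.≤ dmin) × (dmin ℚ.≤ dmax)
    × (∀ u v → ζ u ≡ ζ v → u ≡ v)
    × (∀ u → IsLeaf T (ζ u))
    × (∀ x → IsLeaf T x → ∃ λ u → ζ u ≡ x)
    -- uv ∈ E ⇔ dmin ≤ d_T(ζ u, ζ v) ≤ dmax  (d_T = weight of the unique path)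
    × (∀ u v → u ≢ v → ∀ vs → IsPath (WTree.adj T) (ζ u) (ζ v) vs →
        (Edge G u v ⇔ (dmin ℚ.≤ pathWeight (WTree.weight T) vs
                        × pathWeight (WTree.weight T) vs ℚ.≤ dmax)))

count : (k : ℕ) → (Fin k → Bool) → ℕ
count k f = sum (map (λ i → if f i then 1 else 0) (allFin k))

IsThresholdPCG : ∀ {n} → (k t : ℕ) → Graph n → Set
IsThresholdPCG {n} k t G =
  Σ (Fin k → Graph n) λ Gs →
    (∀ i → IsPCG (Gs i))
    × (∀ u v → u ≢ v →
        (Edge G u v ⇔ (t ≤ count k (λ i → Graph.adj (Gs i) u v))))

module Submission where

-- Write t = c + 1 and C = {j : j < c}.  The i-th PCG keeps the true
-- neighbourhood of i and, on the other vertices, is a clique on a set S_i: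
-- S_i = V for i ∈ C, S_c = C, and S_i = ∅ otherwise.  Such a graph is a PCG
-- of a star tree: a leaf-to-leaf distance is the sum of two leaf weights, and
-- four weights suffice to encode "in S_i" and "adjacent to i".  A pair uv gets
-- two votes from the layers u and v exactly when uv ∈ E, and c or c − 1
-- votes from the other layers, so it gets at least c + 1 votes iff uv ∈ E.

open import Defs
open import Data.Bool using (Bool; true; false; if_then_else_; not; _∧_; _∨_)
open import Data.Empty using (⊥-elim)
open import Data.Fin using (Fin; zero; suc; toℕ; _≟_)
open import Data.Fin.Properties using (suc-injective)
open import Data.Integer using (+_)
open import Data.List using (List; []; _∷_)
open import Data.List.Properties using (map-tabulate)
open import Data.List.Relation.Unary.All using ([]; _∷_)
open import Data.List.Relation.Unary.AllPairs using ([]; _∷_)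
open import Data.Nat as ℕ using (ℕ; _+_; _≤_; _<_; _<ᵇ_; _≡ᵇ_; z≤n; s≤s; s≤s⁻¹)
open import Data.Nat.ListAction using (sum)
open import Data.Nat.Properties using (+-mono-≤; +-mono-≤-<; ≤-trans; n≤1+n; ≤⇒≯)
open import Data.Product using (∃; _×_; _,_)
open import Data.Rational as ℚ using (ℚ; 0ℚ; _/_; _≤?_)
import Data.Rational.Properties as ℚ
open import Data.Sum using (_⊎_; inj₁; inj₂)
open import Function using (_∘_; id; flip)
open import Function.Bundles using (_⇔_; mk⇔)
open import Relation.Binary.PropositionalEquality
open import Relation.Nullary using (does; proof; yes; no; Reflects; invert)
open import Relation.Nullary.Decidable using (_×-dec_; dec-true; dec-false; does-⇔; from-yes)

_⊆_ : ∀ {k} → (Fin k → Bool) → (Fin k → Bool) → Set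
f ⊆ g = ∀ i → f i ≡ true → g i ≡ true

count-suc : ∀ k (f : Fin (ℕ.suc k) → Bool) →
  count (ℕ.suc k) f ≡ (if f zero then 1 else 0) + count k (f ∘ suc)
count-suc k f = cong (λ rest → (if f zero then 1 else 0) + rest) (cong sum
  (trans (map-tabulate suc bit) (sym (map-tabulate id (bit ∘ suc)))))
  where
  bit : Fin (ℕ.suc k) → ℕ
  bit i = if f i then 1 else 0

bit-mono : ∀ {a b} → (a ≡ true → b ≡ true) → (if a then 1 else 0) ≤ (if b then 1 else 0)
bit-mono {false}        _   = z≤n
bit-mono {true} {true}  _   = s≤s z≤n
bit-mono {true} {false} a⇒b with () ← a⇒b refl

count-mono : ∀ k {f g : Fin k → Bool} → f ⊆ g → count k f ≤ count k g
count-mono ℕ.zero    f⊆g = z≤n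
count-mono (ℕ.suc k) {f} {g} f⊆g rewrite count-suc k f | count-suc k g =
  +-mono-≤ (bit-mono (f⊆g zero)) (count-mono k (f⊆g ∘ suc))

count-mono-< : ∀ k {f g : Fin k → Bool} → f ⊆ g →
  ∀ u → f u ≡ false → g u ≡ true → count k f < count k g
count-mono-< (ℕ.suc k) {f} {g} f⊆g u fu gu rewrite count-suc k f | count-suc k g with u
... | zero  rewrite fu | gu = s≤s (count-mono k (f⊆g ∘ suc))
... | suc u = +-mono-≤-< (bit-mono (f⊆g zero)) (count-mono-< k (f⊆g ∘ suc) u fu gu)

count-prefix : ∀ {k m} → m ≤ k → count k (λ i → toℕ i <ᵇ m) ≡ m
count-prefix {ℕ.zero}  z≤n = refl
count-prefix {ℕ.suc k} {ℕ.zero} _ =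
  trans (count-suc k (λ i → toℕ i <ᵇ 0)) (count-prefix {k} z≤n)
count-prefix {ℕ.suc k} {ℕ.suc m} (s≤s m≤k) =
  trans (count-suc k (λ i → toℕ i <ᵇ ℕ.suc m)) (cong ℕ.suc (count-prefix m≤k))

within : ℚ → ℚ → ℚ → Bool
within dmin dmax x = does (dmin ≤? x ×-dec x ≤? dmax)

within⇔ : ∀ {dmin dmax x} → within dmin dmax x ≡ true ⇔ (dmin ℚ.≤ x × x ℚ.≤ dmax)
within⇔ {dmin} {dmax} {x} =
  mk⇔ (λ holds → invert (subst (Reflects _) holds (proof d))) (dec-true d)
  where d = dmin ≤? x ×-dec x ≤? dmax

sumGraph : ∀ {n} → (Fin n → ℚ) → ℚ → ℚ → Graph n
sumGraph f dmin dmax = record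
  { adj    = λ u v → not (does (u ≟ v)) ∧ within dmin dmax (f u ℚ.+ f v)
  ; sym    = λ u v → cong₂ (λ b x → not b ∧ within dmin dmax x)
                       (does-⇔ (mk⇔ sym sym) (u ≟ v) (v ≟ u)) (ℚ.+-comm (f u) (f v))
  ; irrefl = λ u → cong (λ b → not b ∧ within dmin dmax (f u ℚ.+ f u)) (dec-true (u ≟ u) refl)
  }

sumGraph-adj : ∀ {n} (f : Fin n → ℚ) dmin dmax {u v} → u ≢ v →
  Graph.adj (sumGraph f dmin dmax) u v ≡ within dmin dmax (f u ℚ.+ f v)
sumGraph-adj f dmin dmax {u} {v} u≢v =
  cong (λ b → not b ∧ within dmin dmax (f u ℚ.+ f v)) (dec-false (u ≟ v) u≢v)

module StarTree {n : ℕ} (f : Fin n → ℚ) (f-nonneg : ∀ j → 0ℚ ℚ.≤ f j) where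

  starAdj : Fin (ℕ.suc n) → Fin (ℕ.suc n) → Bool
  starAdj zero    zero    = false
  starAdj zero    (suc _) = true
  starAdj (suc _) zero    = true
  starAdj (suc _) (suc _) = false

  starPath : Fin (ℕ.suc n) → Fin (ℕ.suc n) → List (Fin (ℕ.suc n))
  starPath zero    zero    = zero ∷ []
  starPath zero    (suc j) = zero ∷ suc j ∷ []
  starPath (suc i) zero    = suc i ∷ zero ∷ []
  starPath (suc i) (suc j) with i ≟ j
  ... | yes _ = suc i ∷ []
  ... | no  _ = suc i ∷ zero ∷ suc j ∷ []

  starPath-isPath : ∀ x y → IsPath starAdj x y (starPath x y)
  starPath-isPath zero    zero    = here zero , [] ∷ []
  starPath-isPath zero    (suc j) = step refl (here (suc j)) , ((λ ()) ∷ []) ∷ [] ∷ []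
  starPath-isPath (suc i) zero    = step refl (here zero) , ((λ ()) ∷ []) ∷ [] ∷ []
  starPath-isPath (suc i) (suc j) with i ≟ j
  ... | yes refl = here (suc i) , [] ∷ []
  ... | no  i≢j  = step refl (step refl (here (suc j))) ,
                   ((λ ()) ∷ (i≢j ∘ suc-injective) ∷ []) ∷ ((λ ()) ∷ []) ∷ [] ∷ []

  starPath-leaves : ∀ {i j} → i ≢ j → starPath (suc i) (suc j) ≡ suc i ∷ zero ∷ suc j ∷ []
  starPath-leaves {i} {j} i≢j with i ≟ j
  ... | yes i≡j = ⊥-elim (i≢j i≡j)
  ... | no  _   = refl

  path-from-centre : ∀ {y vs} → IsPath starAdj zero y vs → vs ≡ starPath zero y
  path-from-centre (here _ , _) = refl
  path-from-centre (step {y = suc _} _ (here _) , _) = refl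
  path-from-centre (step {y = suc _} _ (step {y = suc _} () _) , _)
  path-from-centre (step {y = suc _} _ (step {y = zero} _ (here _)) , (_ ∷ 0≢0 ∷ _) ∷ _) =
    ⊥-elim (0≢0 refl)
  path-from-centre (step {y = suc _} _ (step {y = zero} _ (step _ _)) , (_ ∷ 0≢0 ∷ _) ∷ _) =
    ⊥-elim (0≢0 refl)

  path-from-leaf : ∀ {i y vs} → IsPath starAdj (suc i) y vs → vs ≡ starPath (suc i) y
  path-from-leaf {i} (here _ , _) with i ≟ i
  ... | yes _   = refl
  ... | no  i≢i = ⊥-elim (i≢i refl)
  path-from-leaf (step {y = suc _} () _ , _)
  path-from-leaf {y = zero} (step {y = zero} _ rest , _ ∷ unique)
    with refl ← path-from-centre (rest , unique) = refl
  path-from-leaf {y = suc j} (step {y = zero} _ rest , distinct ∷ unique)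
    with refl ← path-from-centre (rest , unique) | _ ∷ si≢sj ∷ [] ← distinct
    = sym (starPath-leaves (si≢sj ∘ cong suc))

  starPath-unique : ∀ {x y vs} → IsPath starAdj x y vs → vs ≡ starPath x y
  starPath-unique {zero}  = path-from-centre
  starPath-unique {suc _} = path-from-leaf

  starWeight : Fin (ℕ.suc n) → Fin (ℕ.suc n) → ℚ
  starWeight zero    zero    = 0ℚ
  starWeight zero    (suc j) = f j
  starWeight (suc i) zero    = f i
  starWeight (suc _) (suc _) = 0ℚ

  starTree : WTree
  starTree = record
    { size          = ℕ.suc n
    ; adj           = starAdj
    ; sym           = λ { zero zero → refl ; zero (suc _) → refl
                        ; (suc _) zero → refl ; (suc _) (suc _) → refl }
    ; irrefl        = λ { zero → refl ; (suc _) → refl }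
    ; connected     = λ x y → starPath x y , starPath-isPath x y
    ; acyclic       = λ _ _ _ _ p q → trans (starPath-unique p) (sym (starPath-unique q))
    ; weight        = starWeight
    ; weight-sym    = λ { zero zero → refl ; zero (suc _) → refl
                        ; (suc _) zero → refl ; (suc _) (suc _) → refl }
    ; weight-nonneg = λ { zero zero → ℚ.≤-refl ; zero (suc j) → f-nonneg j
                        ; (suc i) zero → f-nonneg i ; (suc _) (suc _) → ℚ.≤-refl }
    }

  leaf-suc : ∀ j → IsLeaf starTree (suc j)
  leaf-suc _ zero    zero    _  _  = refl
  leaf-suc _ zero    (suc _) _  ()
  leaf-suc _ (suc _) _       () _

pointTree : WTree
pointTree = record
  { size          = 1
  ; adj           = λ _ _ → false
  ; sym           = λ _ _ → refl
  ; irrefl        = λ _ → refl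
  ; connected     = λ { zero zero → zero ∷ [] , here zero , [] ∷ [] }
  ; acyclic       = λ { _ _ _ _ (here _ , _) (here _ , _) → refl
                      ; _ _ _ _ (step () _ , _) _
                      ; _ _ _ _ _ (step () _ , _) }
  ; weight        = λ _ _ → 0ℚ
  ; weight-sym    = λ _ _ → refl
  ; weight-nonneg = λ _ _ → ℚ.≤-refl
  }

Graph₁-isPCG : (G : Graph 1) → IsPCG G
Graph₁-isPCG G = pointTree , 0ℚ , 0ℚ , id , ℚ.≤-refl , ℚ.≤-refl , (λ _ _ → id) ,
  (λ { _ _ _ () _ }) , (λ x _ → x , refl) , λ { zero zero 0≢0 → ⊥-elim (0≢0 refl) }

-- With a single leaf the centre of the star would be a leaf too, so one
-- vertex is handled by the one-point tree.
sumGraph-isPCG : ∀ {n} (f : Fin (ℕ.suc n) → ℚ) {dmin dmax} → (∀ j → 0ℚ ℚ.≤ f j) →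
  0ℚ ℚ.≤ dmin → dmin ℚ.≤ dmax → IsPCG (sumGraph f dmin dmax)
sumGraph-isPCG {ℕ.zero} f {dmin} {dmax} _ _ _ = Graph₁-isPCG (sumGraph f dmin dmax)
sumGraph-isPCG {ℕ.suc m} f {dmin} {dmax} nonneg 0≤dmin dmin≤dmax =
  starTree , dmin , dmax , suc , 0≤dmin , dmin≤dmax , (λ _ _ → suc-injective) ,
  leaf-suc , leaf-inverse , distance
  where
  open StarTree f nonneg

  leaf-inverse : ∀ x → IsLeaf starTree x → ∃ λ u → suc u ≡ x
  leaf-inverse zero    leaf with () ← leaf (suc zero) (suc (suc zero)) refl refl
  leaf-inverse (suc u) _    = u , refl

  distance : ∀ u v → u ≢ v → ∀ vs → IsPath starAdj (suc u) (suc v) vs →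
    (Edge (sumGraph f dmin dmax) u v ⇔
      (dmin ℚ.≤ pathWeight starWeight vs × pathWeight starWeight vs ℚ.≤ dmax))
  distance u v u≢v vs path
    rewrite starPath-unique path | starPath-leaves u≢v | ℚ.+-identityʳ (f v)
          | sumGraph-adj f dmin dmax u≢v = within⇔

-- rimWeight a e encodes membership a in the clique and adjacency e to the
-- centre.  In the window [6, 12] the centre (weight 0) sees exactly the
-- weights 6 and 9, two weights from {4, 6} always sum into the window, and a
-- sum involving 9 or 13 exceeds 12.
inWindow : ℚ → Bool
inWindow = within (+ 6 / 1) (+ 12 / 1)

rimWeight : Bool → Bool → ℚ
rimWeight true  true  = + 6 / 1
rimWeight true  false = + 4 / 1
rimWeight false true  = + 9 / 1
rimWeight false false = + 13 / 1

rimWeight-nonneg : ∀ a e → 0ℚ ℚ.≤ rimWeight a e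
rimWeight-nonneg true  true  = from-yes (0ℚ ≤? + 6 / 1)
rimWeight-nonneg true  false = from-yes (0ℚ ≤? + 4 / 1)
rimWeight-nonneg false true  = from-yes (0ℚ ≤? + 9 / 1)
rimWeight-nonneg false false = from-yes (0ℚ ≤? + 13 / 1)

within-centre : ∀ a e → inWindow (0ℚ ℚ.+ rimWeight a e) ≡ e
within-centre true  true  = refl
within-centre true  false = refl
within-centre false true  = refl
within-centre false false = refl

within-rim : ∀ a e b f →
  inWindow (rimWeight a e ℚ.+ rimWeight b f) ≡ a ∧ b
within-rim true  true  true  true  = refl
within-rim true  true  true  false = refl
within-rim true  true  false true  = refl
within-rim true  true  false false = refl
within-rim true  false true  true  = refl
within-rim true  false true  false = refl
within-rim true  false false true  = refl
within-rim true  false false false = refl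
within-rim false true  true  true  = refl
within-rim false true  true  false = refl
within-rim false true  false true  = refl
within-rim false true  false false = refl
within-rim false false true  true  = refl
within-rim false false true  false = refl
within-rim false false false true  = refl
within-rim false false false false = refl

module _ {n} (G : Graph n) (i : Fin n) (S : Fin n → Bool) where
  open Graph G using (adj)

  layerWeight : Fin n → ℚ
  layerWeight j = if does (j ≟ i) then 0ℚ else rimWeight (S j) (adj i j)

  starClique : Graph n
  starClique = sumGraph layerWeight (+ 6 / 1) (+ 12 / 1)

  layerWeight-centre : layerWeight i ≡ 0ℚ
  layerWeight-centre = cong (if_then 0ℚ else _) (dec-true (i ≟ i) refl)

  layerWeight-rim : ∀ {j} → j ≢ i → layerWeight j ≡ rimWeight (S j) (adj i j)
  layerWeight-rim j≢i = cong (if_then 0ℚ else _) (dec-false (_ ≟ i) j≢i)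

  starClique-centre : ∀ {v} → v ≢ i → Graph.adj starClique i v ≡ adj i v
  starClique-centre {v} v≢i = begin
    Graph.adj starClique i v
      ≡⟨ sumGraph-adj layerWeight (+ 6 / 1) (+ 12 / 1) (v≢i ∘ sym) ⟩
    inWindow (layerWeight i ℚ.+ layerWeight v)
      ≡⟨ cong₂ (λ x y → inWindow (x ℚ.+ y))
           layerWeight-centre (layerWeight-rim v≢i) ⟩
    inWindow (0ℚ ℚ.+ rimWeight (S v) (adj i v))
      ≡⟨ within-centre (S v) (adj i v) ⟩
    adj i v ∎
    where open ≡-Reasoning

  starClique-rim : ∀ {u v} → u ≢ i → v ≢ i → u ≢ v →
    Graph.adj starClique u v ≡ S u ∧ S v
  starClique-rim {u} {v} u≢i v≢i u≢v = begin
    Graph.adj starClique u v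
      ≡⟨ sumGraph-adj layerWeight (+ 6 / 1) (+ 12 / 1) u≢v ⟩
    inWindow (layerWeight u ℚ.+ layerWeight v)
      ≡⟨ cong₂ (λ x y → inWindow (x ℚ.+ y))
           (layerWeight-rim u≢i) (layerWeight-rim v≢i) ⟩
    inWindow (rimWeight (S u) (adj i u) ℚ.+ rimWeight (S v) (adj i v))
      ≡⟨ within-rim (S u) (adj i u) (S v) (adj i v) ⟩
    S u ∧ S v ∎
    where open ≡-Reasoning

starClique-isPCG : ∀ {n} (G : Graph (ℕ.suc n)) i S → IsPCG (starClique G i S)
starClique-isPCG G i S = sumGraph-isPCG (layerWeight G i S) layerWeight-nonneg
  (from-yes (0ℚ ≤? + 6 / 1)) (from-yes (+ 6 / 1 ≤? + 12 / 1))
  where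
  layerWeight-nonneg : ∀ j → 0ℚ ℚ.≤ layerWeight G i S j
  layerWeight-nonneg j with does (j ≟ i)
  ... | true  = ℚ.≤-refl
  ... | false = rimWeight-nonneg (S j) (Graph.adj G i j)

module Votes {n} (G : Graph n) (S : Fin n → Fin n → Bool) where
  open Graph G using (adj)

  votes : Fin n → Fin n → Fin n → Bool
  votes u v i = Graph.adj (starClique G i (S i)) u v

  votes-endpointˡ : ∀ {u v} → u ≢ v → votes u v u ≡ adj u v
  votes-endpointˡ u≢v = starClique-centre G _ (S _) (u≢v ∘ sym)

  votes-endpointʳ : ∀ {u v} → u ≢ v → votes u v v ≡ adj u v
  votes-endpointʳ {u} {v} u≢v = begin
    votes u v v                          ≡⟨ Graph.sym (starClique G v (S v)) u v ⟩
    Graph.adj (starClique G v (S v)) v u ≡⟨ starClique-centre G v (S v) u≢v ⟩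
    adj v u                              ≡⟨ Graph.sym G v u ⟩
    adj u v                              ∎
    where open ≡-Reasoning

  votes-bystander : ∀ {u v i} → u ≢ v → i ≢ u → i ≢ v → votes u v i ≡ S i u ∧ S i v
  votes-bystander u≢v i≢u i≢v = starClique-rim G _ (S _) (i≢u ∘ sym) (i≢v ∘ sym) u≢v

  votes-edge : ∀ {u v} → u ≢ v → adj u v ≡ true → (λ i → S i u ∧ S i v) ⊆ votes u v
  votes-edge {u} {v} u≢v uv i both with i ≟ u | i ≟ v
  ... | yes refl | _        = trans (votes-endpointˡ u≢v) uv
  ... | no  _    | yes refl = trans (votes-endpointʳ u≢v) uv
  ... | no  i≢u  | no  i≢v  = trans (votes-bystander u≢v i≢u i≢v) both

  votes-nonedge : ∀ {u v} → u ≢ v → adj u v ≡ false → votes u v ⊆ (λ i → S i u ∧ S i v)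
  votes-nonedge {u} {v} u≢v uv i vote with i ≟ u | i ≟ v
  ... | yes refl | _        with () ← trans (sym vote) (trans (votes-endpointˡ u≢v) uv)
  ... | no  _    | yes refl with () ← trans (sym vote) (trans (votes-endpointʳ u≢v) uv)
  ... | no  i≢u  | no  i≢v  = trans (sym (votes-bystander u≢v i≢u i≢v)) vote

<ᵇ-suc : ∀ a c → (a <ᵇ ℕ.suc c) ≡ ((a <ᵇ c) ∨ (a ≡ᵇ c))
<ᵇ-suc ℕ.zero    ℕ.zero    = refl
<ᵇ-suc ℕ.zero    (ℕ.suc c) = refl
<ᵇ-suc (ℕ.suc a) ℕ.zero    = refl
<ᵇ-suc (ℕ.suc a) (ℕ.suc c) = <ᵇ-suc a c

module Threshold {n} (G : Graph n) (c : ℕ) (c<n : c < n) where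
  open Graph G using (adj)

  below : ℕ → Fin n → Bool
  below m j = toℕ j <ᵇ m

  clique : Fin n → Fin n → Bool
  clique i j = below c i ∨ ((toℕ i ≡ᵇ c) ∧ below c j)

  open Votes G clique public

  clique-of-below : ∀ {i u v} → below c i ≡ true → clique i u ∧ clique i v ≡ true
  clique-of-below below-i rewrite below-i = refl

  below-suc : ∀ {j} → below c j ≡ true → below (ℕ.suc c) j ≡ true
  below-suc {j} below-j rewrite <ᵇ-suc (toℕ j) c | below-j = refl

  clique-below-suc : ∀ {i u v} → clique i u ∧ clique i v ≡ true → below (ℕ.suc c) i ≡ true
  clique-below-suc {i} rewrite <ᵇ-suc (toℕ i) c with below c i | toℕ i ≡ᵇ c
  ... | true  | _     = λ _ → refl
  ... | false | true  = λ _ → refl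
  ... | false | false = λ ()

  clique-both : ∀ {i u v} → below (ℕ.suc c) i ≡ true → below c u ≡ true → below c v ≡ true →
    clique i u ∧ clique i v ≡ true
  clique-both {i} below-i below-u below-v rewrite below-u | below-v
    with below c i | toℕ i ≡ᵇ c | trans (sym (<ᵇ-suc (toℕ i) c)) below-i
  ... | true  | _     | _  = refl
  ... | false | true  | _  = refl
  ... | false | false | ()

  clique-outside : ∀ {i u v} → clique i u ∧ clique i v ≡ true →
    below c u ≡ false ⊎ below c v ≡ false → below c i ≡ true
  clique-outside {i} {u} {v} with below c i | toℕ i ≡ᵇ c | below c u | below c v
  ... | true  | _     | _     | _     = λ _ _ → refl
  ... | false | true  | true  | true  = λ { _ (inj₁ ()) ; _ (inj₂ ()) }
  ... | false | true  | true  | false = λ ()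
  ... | false | true  | false | _     = λ ()
  ... | false | false | _     | _     = λ ()

  below-cases : ∀ u v → below c u ≡ true × below c v ≡ true ⊎ (below c u ≡ false ⊎ below c v ≡ false)
  below-cases u v with below c u | below c v
  ... | true  | true  = inj₁ (refl , refl)
  ... | false | _     = inj₂ (inj₁ refl)
  ... | true  | false = inj₂ (inj₂ refl)

  count-below : count n (below c) ≡ c
  count-below = count-prefix (≤-trans (n≤1+n c) c<n)

  quorum-via-outsider : ∀ {u v} w → u ≢ v → adj u v ≡ true → below c w ≡ false → votes u v w ≡ true →
    ℕ.suc c ≤ count n (votes u v)
  quorum-via-outsider {u} {v} w u≢v uv outside vote = subst (_< count n (votes u v)) count-below
    (count-mono-< n (λ i → votes-edge u≢v uv i ∘ clique-of-below) w outside vote)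

  edge⇒quorum : ∀ {u v} → u ≢ v → adj u v ≡ true → ℕ.suc c ≤ count n (votes u v)
  edge⇒quorum {u} {v} u≢v uv with below-cases u v
  ... | inj₁ (bu , bv) = subst (_≤ count n (votes u v)) (count-prefix c<n)
    (count-mono n (λ i below-i → votes-edge u≢v uv i (clique-both below-i bu bv)))
  ... | inj₂ (inj₁ bu) = quorum-via-outsider u u≢v uv bu (trans (votes-endpointˡ u≢v) uv)
  ... | inj₂ (inj₂ bv) = quorum-via-outsider v u≢v uv bv (trans (votes-endpointʳ u≢v) uv)

  nonedge⇒minority : ∀ {u v} → u ≢ v → adj u v ≡ false → count n (votes u v) ≤ c
  nonedge⇒minority {u} {v} u≢v uv with below-cases u v
  ... | inj₁ (bu , _) = s≤s⁻¹ (subst (count n (votes u v) <_) (count-prefix c<n)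
    (count-mono-< n (λ i → clique-below-suc ∘ votes-nonedge u≢v uv i) u
      (trans (votes-endpointˡ u≢v) uv) (below-suc bu)))
  ... | inj₂ outside = subst (count n (votes u v) ≤_) count-below
    (count-mono n (λ i → flip clique-outside outside ∘ votes-nonedge u≢v uv i))

  threshold-votes : ∀ {u v} → u ≢ v → Edge G u v ⇔ (ℕ.suc c ≤ count n (votes u v))
  threshold-votes {u} {v} u≢v = mk⇔ (edge⇒quorum u≢v) quorum⇒edge
    where
    quorum⇒edge : ℕ.suc c ≤ count n (votes u v) → adj u v ≡ true
    quorum⇒edge quorum with adj u v in uv
    ... | true  = refl
    ... | false = ⊥-elim (≤⇒≯ (nonedge⇒minority u≢v uv) quorum)

theorem9 : (n t : ℕ) → 1 ≤ n → 1 ≤ t → t ≤ n →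
    (G : Graph n) → IsThresholdPCG n t G
theorem9 _           ℕ.zero    _ () _ _
theorem9 ℕ.zero      (ℕ.suc c) _ _ () _
theorem9 (ℕ.suc n) (ℕ.suc c) _ _ c<n G =
  (λ i → starClique G i (clique i)) ,
  (λ i → starClique-isPCG G i (clique i)) ,
  (λ _ _ → threshold-votes)
  where open Threshold G c c<n
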